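{- For any $1<t\le 2$, any $\varepsilon>0$, and any $t$-competitive deterministic online algorithm for the maximum independent set problem in the recourse model, there exists an instance on which the algorithm incurs at least $\frac{1}{t-1}-\varepsilon$ amortized recourse.
   Context: Online maximum independent set (vertex-arrival): vertices of an unknown graph arrive one at a time with their edges to previously revealed vertices; the online algorithm maintains an independent set of the revealed graph, accepting or rejecting each new vertex, and may later change any vertex's status (late-accept or late-reject), each change costing one unit of recourse. The algorithm is $t$-competitive if its maintained independent set always has size at least $1/t$ times the maximum independent set size of the currently revealed graph. Amortized recourse = total number of status changes divided by the number of vertices of the final graph. -}

module Defs where

open import Data.Nat as ℕ using (ℕ; zero; suc)
open import Data.Fin using (Fin; zero; suc)
open import Data.Bool using (Bool; true; false)
import Data.Bool
import Relation.Nullary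
open import Data.Vec using (Vec; []; _∷_; lookup; init)
open import Data.Fin.Subset using (Subset; _∈_; ∣_∣)
open import Data.Sum using (_⊎_; inj₁; inj₂)
open import Data.Unit using (⊤; tt)
open import Data.Product using (Σ; _,_)
open import Data.Integer using (+_)
open import Relation.Binary.PropositionalEquality using (_≡_; subst)
open import Data.Rational as ℚ using (ℚ; 0ℚ; 1ℚ; _<_; _≤_; _-_; _*_; 1/_; Positive)
open import Data.Rational.Properties using (pos⇒nonZero; +-monoˡ-<; +-inverseʳ)

-- An instance with n vertices is the sequence of arrivals: vertex k
-- (k = 0, 1, …, n-1, as an element of Fin n) arrives k-th, together
-- with the set of its neighbours among the previously revealed vertices
-- 0, …, k-1 (a Subset k).  The prefix of length k of an instance is the
-- graph revealed after k arrivals.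

data Arrivals : ℕ → Set where
  []  : Arrivals 0
  _▷_ : ∀ {n} → Arrivals n → Subset n → Arrivals (suc n)

-- Vertex i : Fin (suc n) is either an old vertex (i < n) or the new one (i = n).
lastView : ∀ n → Fin (suc n) → Fin n ⊎ ⊤
lastView zero    zero    = inj₂ tt
lastView (suc n) zero    = inj₁ zero
lastView (suc n) (suc i) with lastView n i
... | inj₁ j  = inj₁ (suc j)
... | inj₂ tt = inj₂ tt

adj : ∀ {n} → Arrivals n → Fin n → Fin n → Bool
adj [] ()
adj {suc n} (G ▷ s) i j with lastView n i | lastView n j
... | inj₁ a  | inj₁ b  = adj G a b
... | inj₁ a  | inj₂ _  = lookup s a
... | inj₂ _  | inj₁ b  = lookup s b
... | inj₂ _  | inj₂ _  = false

Independent : ∀ {n} → Arrivals n → Subset n → Set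
Independent {n} G S = ∀ (i j : Fin n) → i ∈ S → j ∈ S → adj G i j ≡ false

-- Being deterministic, the independent set it maintains after k arrivals
-- is a function of the revealed arrival sequence of length k.
-- (In Subset (suc n) = Vec Bool (suc n) the newest vertex is the last
-- entry, so `init` gives the status of the old vertices.)

OnlineAlg : Set
OnlineAlg = ∀ n → Arrivals n → Subset n

changes : ∀ {n} → Vec Bool n → Vec Bool n → ℕ
changes []       []       = 0
changes (x ∷ xs) (y ∷ ys) with Data.Bool._≟_ x y
... | Relation.Nullary.yes _ = changes xs ys
... | Relation.Nullary.no  _ = suc (changes xs ys)

-- The initial decision on the arriving vertex is free.
recourse : OnlineAlg → ∀ {n} → Arrivals n → ℕ
recourse A []                = 0
recourse A {suc n} (G ▷ s)   = recourse A G ℕ.+ changes (A n G) (init (A (suc n) (G ▷ s)))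

amortizedRecourse : OnlineAlg → ∀ {n} → Arrivals (suc n) → ℚ
amortizedRecourse A {n} G = (+ recourse A G) ℚ./ suc n

Valid : OnlineAlg → Set
Valid A = ∀ n (G : Arrivals n) → Independent G (A n G)

-- t-competitive: at all times |maintained set| ≥ (1/t)·α(revealed graph),
-- i.e. every independent set S of the revealed graph has |S| ≤ t·|A n G|.
Competitive : ℚ → OnlineAlg → Set
Competitive t A = ∀ n (G : Arrivals n) (S : Subset n) → Independent G S →
  (+ ∣ S ∣) ℚ./ 1 ≤ t * ((+ ∣ A n G ∣) ℚ./ 1)

1<⇒pos : ∀ t → 1ℚ < t → Positive (t - 1ℚ)
1<⇒pos t h = ℚ.positive (subst (_< t - 1ℚ) (+-inverseʳ 1ℚ) (+-monoˡ-< (ℚ.- 1ℚ) h))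

inv[t-1] : (t : ℚ) → 1ℚ < t → ℚ
inv[t-1] t h = (1/ (t - 1ℚ)) {{pos⇒nonZero (t - 1ℚ) {{1<⇒pos t h}}}}

-- The adversary keeps the revealed graph complete bipartite, its two sides given by vertex labels, with the
-- algorithm's set S inside one side P; every new vertex joins the other side Q and is adjacent to all of P.
-- Either S stays in P, so that q = |Q| grows while p = |P| does not, or S moves to Q, which forces the
-- algorithm to reject all of S and to late-accept almost all of its new set: about |S| + |S′| changes.
-- With u = t − 1, t-competitiveness gives q ≤ t|S| and |S| ≤ p, so the excess u|S| + p − q is nonnegative.
-- After k arrivals with total recourse R, the potential (u + δ)R − k − (u|S| + p − q) never decreases in a
-- staying round; a switching round loses at most u + 2 but gains δ times its cost, and that cost grows
-- linearly with k because |S′| ≥ k/(2t). So the potential is bounded below, R ≥ (k − O(1))/(u + δ), and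
-- δ = εu² turns this into R/k ≥ 1/u − ε for large k.

module Submission where

open import Data.Bool using (Bool; true; false; not; _xor_; if_then_else_)
open import Data.Bool.Properties using (xor-same; xor-inverseʳ; xor-comm; not-involutive; not-¬; ¬-not)
  renaming (_≟_ to _≟ᵇ_)
open import Data.Empty using (⊥-elim)
open import Data.Fin using (Fin; zero; suc; inject₁; fromℕ)
open import Data.Fin.Properties using (any?)
open import Data.Fin.Subset using (Subset; _∈_; _∉_; _⊆_; ∣_∣)
open import Data.Fin.Subset.Properties using (_∈?_; p⊆q⇒∣p∣≤∣q∣)
open import Data.Integer as ℤ using (+_)
import Data.Integer.Properties as ℤ
open import Data.Nat as ℕ using (ℕ; zero; suc; z≤n; s≤s)
import Data.Nat.Properties as ℕ
open import Data.Nat.Coprimality using (1-coprimeTo)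
import Data.Nat.Coprimality as Coprime
open import Data.Product using (Σ; ∃; _×_; _,_; proj₁; proj₂)
open import Data.Rational as ℚ
  using (ℚ; mkℚ; 0ℚ; 1ℚ; _+_; _*_; _-_; -_; _/_; _≤_; _<_; *≤*; toℚᵘ; 1/_; Positive)
import Data.Rational.Properties as ℚ
import Data.Rational.Unnormalised as ℚᵘ
import Data.Rational.Unnormalised.Properties as ℚᵘ
open import Data.Sum using (inj₁; inj₂)
open import Data.Unit using (tt)
open import Data.Vec using (Vec; []; _∷_; lookup; init; map; _∷ʳ_; here; there)
open import Data.Vec.Properties using (map-∷ʳ; lookup-map; []=⇒lookup; lookup⇒[]=)
open import Function using (_∘_)
open import Relation.Binary.PropositionalEquality
open import Relation.Nullary using (Dec; yes; no; does)
open import Relation.Nullary.Decidable using (_×-dec_; dec⇒maybe)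
import Tactic.RingSolver.Core.AlmostCommutativeRing as ACR
open import Tactic.RingSolver using (solve-∀)

open import Defs

lookup-∷ʳ-old : ∀ {A : Set} {n} (xs : Vec A n) (x : A) {i j} →
  lastView n i ≡ inj₁ j → lookup (xs ∷ʳ x) i ≡ lookup xs j
lookup-∷ʳ-old {n = suc n} (y ∷ xs) x {zero}  refl = refl
lookup-∷ʳ-old {n = suc n} (y ∷ xs) x {suc i} eq with lastView n i in eq′
lookup-∷ʳ-old {n = suc n} (y ∷ xs) x {suc i} refl | inj₁ j = lookup-∷ʳ-old xs x eq′

lookup-∷ʳ-new : ∀ {A : Set} {n} (xs : Vec A n) (x : A) {i} →
  lastView n i ≡ inj₂ tt → lookup (xs ∷ʳ x) i ≡ x
lookup-∷ʳ-new []       x {zero}  refl = refl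
lookup-∷ʳ-new (y ∷ xs) x {suc i} eq with lastView _ i in eq′
lookup-∷ʳ-new (y ∷ xs) x {suc i} refl | inj₂ tt = lookup-∷ʳ-new xs x eq′

lookup-∷ʳ-inject₁ : ∀ {A : Set} {n} (xs : Vec A n) (x : A) i → lookup (xs ∷ʳ x) (inject₁ i) ≡ lookup xs i
lookup-∷ʳ-inject₁ (y ∷ xs) x zero    = refl
lookup-∷ʳ-inject₁ (y ∷ xs) x (suc i) = lookup-∷ʳ-inject₁ xs x i

lookup-∷ʳ-fromℕ : ∀ {A : Set} {n} (xs : Vec A n) (x : A) → lookup (xs ∷ʳ x) (fromℕ n) ≡ x
lookup-∷ʳ-fromℕ []       x = refl
lookup-∷ʳ-fromℕ (y ∷ xs) x = lookup-∷ʳ-fromℕ xs x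

∈init⇒inject₁∈ : ∀ {n} (p : Subset (suc n)) {i} → i ∈ init p → inject₁ i ∈ p
∈init⇒inject₁∈ (x ∷ y ∷ p) here       = here
∈init⇒inject₁∈ (x ∷ y ∷ p) (there i∈) = there (∈init⇒inject₁∈ (y ∷ p) i∈)

∣p∣≤1+∣init∣ : ∀ {n} (p : Subset (suc n)) → ∣ p ∣ ℕ.≤ suc ∣ init p ∣
∣p∣≤1+∣init∣ (true ∷ [])     = ℕ.≤-refl
∣p∣≤1+∣init∣ (false ∷ [])    = z≤n
∣p∣≤1+∣init∣ (true ∷ y ∷ p)  = s≤s (∣p∣≤1+∣init∣ (y ∷ p))
∣p∣≤1+∣init∣ (false ∷ y ∷ p) = ∣p∣≤1+∣init∣ (y ∷ p)

fromℕ∉⇒∣p∣≤∣init∣ : ∀ {n} (p : Subset (suc n)) → fromℕ n ∉ p → ∣ p ∣ ℕ.≤ ∣ init p ∣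
fromℕ∉⇒∣p∣≤∣init∣ (true ∷ [])     n∉p = ⊥-elim (n∉p here)
fromℕ∉⇒∣p∣≤∣init∣ (false ∷ [])    n∉p = z≤n
fromℕ∉⇒∣p∣≤∣init∣ (true ∷ y ∷ p)  n∉p = s≤s (fromℕ∉⇒∣p∣≤∣init∣ (y ∷ p) (n∉p ∘ there))
fromℕ∉⇒∣p∣≤∣init∣ (false ∷ y ∷ p) n∉p = fromℕ∉⇒∣p∣≤∣init∣ (y ∷ p) (n∉p ∘ there)

∣p∷ʳfalse∣ : ∀ {n} (p : Subset n) → ∣ p ∷ʳ false ∣ ≡ ∣ p ∣
∣p∷ʳfalse∣ []          = refl
∣p∷ʳfalse∣ (true ∷ p)  = cong suc (∣p∷ʳfalse∣ p)
∣p∷ʳfalse∣ (false ∷ p) = ∣p∷ʳfalse∣ p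

∣p∷ʳtrue∣ : ∀ {n} (p : Subset n) → ∣ p ∷ʳ true ∣ ≡ suc ∣ p ∣
∣p∷ʳtrue∣ []          = refl
∣p∷ʳtrue∣ (true ∷ p)  = cong suc (∣p∷ʳtrue∣ p)
∣p∷ʳtrue∣ (false ∷ p) = ∣p∷ʳtrue∣ p

∣q∣≤∣p∣+changes : ∀ {n} (p q : Subset n) → ∣ q ∣ ℕ.≤ ∣ p ∣ ℕ.+ changes p q
∣q∣≤∣p∣+changes []          []          = z≤n
∣q∣≤∣p∣+changes (true ∷ p)  (true ∷ q)  = s≤s (∣q∣≤∣p∣+changes p q)
∣q∣≤∣p∣+changes (false ∷ p) (false ∷ q) = ∣q∣≤∣p∣+changes p q
∣q∣≤∣p∣+changes (true ∷ p)  (false ∷ q) =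
  ℕ.≤-trans (∣q∣≤∣p∣+changes p q) (ℕ.m≤n⇒m≤1+n (ℕ.+-monoʳ-≤ ∣ p ∣ (ℕ.n≤1+n _)))
∣q∣≤∣p∣+changes (false ∷ p) (true ∷ q)  =
  ℕ.≤-trans (s≤s (∣q∣≤∣p∣+changes p q)) (ℕ.≤-reflexive (sym (ℕ.+-suc _ _)))

disjoint⇒∣p∣+∣q∣≤changes : ∀ {n} (p q : Subset n) → (∀ {i} → i ∈ p → i ∉ q) →
  ∣ p ∣ ℕ.+ ∣ q ∣ ℕ.≤ changes p q
disjoint⇒∣p∣+∣q∣≤changes []          []          _ = z≤n
disjoint⇒∣p∣+∣q∣≤changes (true ∷ p)  (true ∷ q)  d = ⊥-elim (d here here)
disjoint⇒∣p∣+∣q∣≤changes (true ∷ p)  (false ∷ q) d =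
  s≤s (disjoint⇒∣p∣+∣q∣≤changes p q (λ i∈p → d (there i∈p) ∘ there))
disjoint⇒∣p∣+∣q∣≤changes (false ∷ p) (true ∷ q)  d =
  ℕ.≤-trans (ℕ.≤-reflexive (ℕ.+-suc _ _))
    (s≤s (disjoint⇒∣p∣+∣q∣≤changes p q (λ i∈p → d (there i∈p) ∘ there)))
disjoint⇒∣p∣+∣q∣≤changes (false ∷ p) (false ∷ q) d =
  disjoint⇒∣p∣+∣q∣≤changes p q (λ i∈p → d (there i∈p) ∘ there)

-- Two-sided labellings

-- the vertices labelled b: x xor not b is true exactly when x ≡ b
classOf : ∀ {n} → Vec Bool n → Bool → Subset n
classOf lab b = map (_xor not b) lab

xor-not≡true⇒≡ : ∀ x y → x xor not y ≡ true → x ≡ y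
xor-not≡true⇒≡ false false _ = refl
xor-not≡true⇒≡ true  true  _ = refl

xor≡false⇒≡ : ∀ x y → x xor y ≡ false → x ≡ y
xor≡false⇒≡ false false _ = refl
xor≡false⇒≡ true  true  _ = refl

module _ {n} (lab : Vec Bool n) (b : Bool) where

  ∈classOf⁻ : ∀ {i} → i ∈ classOf lab b → lookup lab i ≡ b
  ∈classOf⁻ {i} i∈ = xor-not≡true⇒≡ _ b (trans (sym (lookup-map i (_xor not b) lab)) ([]=⇒lookup i∈))

  ∈classOf⁺ : ∀ {i} → lookup lab i ≡ b → i ∈ classOf lab b
  ∈classOf⁺ {i} labᵢ≡b = lookup⇒[]= i _ (begin
    lookup (classOf lab b) i  ≡⟨ lookup-map i (_xor not b) lab ⟩
    lookup lab i xor not b    ≡⟨ cong (_xor not b) labᵢ≡b ⟩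
    b xor not b               ≡⟨ xor-inverseʳ b ⟩
    true                      ∎)
    where open ≡-Reasoning

  ∣classOf-∷ʳ-not∣ : ∣ classOf (lab ∷ʳ not b) b ∣ ≡ ∣ classOf lab b ∣
  ∣classOf-∷ʳ-not∣ = begin
    ∣ classOf (lab ∷ʳ not b) b ∣            ≡⟨ cong ∣_∣ (map-∷ʳ (_xor not b) (not b) lab) ⟩
    ∣ classOf lab b ∷ʳ (not b xor not b) ∣  ≡⟨ cong (λ x → ∣ classOf lab b ∷ʳ x ∣) (xor-same (not b)) ⟩
    ∣ classOf lab b ∷ʳ false ∣              ≡⟨ ∣p∷ʳfalse∣ (classOf lab b) ⟩
    ∣ classOf lab b ∣                       ∎
    where open ≡-Reasoning

  ∣classOf-∷ʳ∣ : ∣ classOf (lab ∷ʳ b) b ∣ ≡ suc ∣ classOf lab b ∣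
  ∣classOf-∷ʳ∣ = begin
    ∣ classOf (lab ∷ʳ b) b ∣            ≡⟨ cong ∣_∣ (map-∷ʳ (_xor not b) b lab) ⟩
    ∣ classOf lab b ∷ʳ (b xor not b) ∣  ≡⟨ cong (λ x → ∣ classOf lab b ∷ʳ x ∣) (xor-inverseʳ b) ⟩
    ∣ classOf lab b ∷ʳ true ∣           ≡⟨ ∣p∷ʳtrue∣ (classOf lab b) ⟩
    suc ∣ classOf lab b ∣               ∎
    where open ≡-Reasoning

Monochromatic : ∀ {n} → Vec Bool n → Subset n → Set
Monochromatic lab S = ∀ {i j} → i ∈ S → j ∈ S → lookup lab i ≡ lookup lab j

nextSide : ∀ {n} → Subset n → Vec Bool n → Bool → Bool
nextSide S lab σ = if does (any? λ i → (i ∈? S) ×-dec (lookup lab i ≟ᵇ not σ)) then not σ else σ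

monochromatic⇒⊆classOf-nextSide : ∀ {n} (S : Subset n) lab σ →
  Monochromatic lab S → S ⊆ classOf lab (nextSide S lab σ)
monochromatic⇒⊆classOf-nextSide S lab σ mono = ⊆classOf (any? _)
  where
  ⊆classOf : (d : Dec (∃ λ i → i ∈ S × lookup lab i ≡ not σ)) → S ⊆ classOf lab (if does d then not σ else σ)
  ⊆classOf (yes (i , i∈S , labᵢ≡)) j∈S = ∈classOf⁺ lab (not σ) (trans (mono j∈S i∈S) labᵢ≡)
  ⊆classOf (no none) {j} j∈S =
    ∈classOf⁺ lab σ (trans (¬-not λ labⱼ≡ → none (j , j∈S , labⱼ≡)) (not-involutive σ))

CompleteBipartite : ∀ {n} → Arrivals n → Vec Bool n → Set
CompleteBipartite {n} G lab = ∀ (i j : Fin n) → adj G i j ≡ lookup lab i xor lookup lab j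

module _ {n} (G : Arrivals n) (lab : Vec Bool n) (bip : CompleteBipartite G lab) where

  classOf-independent : ∀ b → Independent G (classOf lab b)
  classOf-independent b i j i∈ j∈ = begin
    adj G i j                     ≡⟨ bip i j ⟩
    lookup lab i xor lookup lab j ≡⟨ cong₂ _xor_ (∈classOf⁻ lab b i∈) (∈classOf⁻ lab b j∈) ⟩
    b xor b                       ≡⟨ xor-same b ⟩
    false                         ∎
    where open ≡-Reasoning

  independent⇒monochromatic : ∀ {S} → Independent G S → Monochromatic lab S
  independent⇒monochromatic indep {i} {j} i∈S j∈S = xor≡false⇒≡ _ _ (trans (sym (bip i j)) (indep i j i∈S j∈S))

  ▷classOf-completeBipartite : ∀ σ → CompleteBipartite (G ▷ classOf lab σ) (lab ∷ʳ not σ)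
  ▷classOf-completeBipartite σ i j with lastView n i in eqᵢ | lastView n j in eqⱼ
  ... | inj₁ a  | inj₁ b  = trans (bip a b)
    (sym (cong₂ _xor_ (lookup-∷ʳ-old lab (not σ) eqᵢ) (lookup-∷ʳ-old lab (not σ) eqⱼ)))
  ... | inj₁ a  | inj₂ tt = trans (lookup-map a (_xor not σ) lab)
    (sym (cong₂ _xor_ (lookup-∷ʳ-old lab (not σ) eqᵢ) (lookup-∷ʳ-new lab (not σ) eqⱼ)))
  ... | inj₂ tt | inj₁ b  = trans (lookup-map b (_xor not σ) lab)
    (sym (trans (cong₂ _xor_ (lookup-∷ʳ-new lab (not σ) eqᵢ) (lookup-∷ʳ-old lab (not σ) eqⱼ))
                (xor-comm (not σ) (lookup lab b))))
  ... | inj₂ tt | inj₂ tt =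
    sym (trans (cong₂ _xor_ (lookup-∷ʳ-new lab (not σ) eqᵢ) (lookup-∷ʳ-new lab (not σ) eqⱼ)) (xor-same (not σ)))

-- One round of the adversary

-- s = |S|, p and q the sizes of the sides containing and avoiding S, c the recourse spent on the arrival,
-- and primes for the same quantities after it.
data Round (s p q c s′ p′ q′ : ℕ) : Set where
  stay   : s′ ℕ.≤ s ℕ.+ c     → p′ ≡ p     → q′ ≡ suc q → Round s p q c s′ p′ q′
  switch : s ℕ.+ s′ ℕ.≤ suc c → p′ ≡ suc q → q′ ≡ p     → Round s p q c s′ p′ q′

module _ {n} (lab : Vec Bool n) (S : Subset n) (S′ : Subset (suc n)) where

  private
    lab′ : Bool → Vec Bool (suc n)
    lab′ σ = lab ∷ʳ not σ

  round-stay : ∀ σ → S ⊆ classOf lab σ → S′ ⊆ classOf (lab′ σ) σ →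
    Round (∣ S ∣) (∣ classOf lab σ ∣) (∣ classOf lab (not σ) ∣) (changes S (init S′))
          (∣ S′ ∣) (∣ classOf (lab′ σ) σ ∣) (∣ classOf (lab′ σ) (not σ) ∣)
  round-stay σ _ S′⊆ = stay
    (ℕ.≤-trans (fromℕ∉⇒∣p∣≤∣init∣ S′ new∉S′) (∣q∣≤∣p∣+changes S (init S′)))
    (∣classOf-∷ʳ-not∣ lab σ)
    (∣classOf-∷ʳ∣ lab (not σ))
    where
    new∉S′ : fromℕ n ∉ S′
    new∉S′ new∈S′ = not-¬ (∈classOf⁻ (lab′ σ) σ (S′⊆ new∈S′)) (lookup-∷ʳ-fromℕ lab (not σ))

  round-switch : ∀ σ → S ⊆ classOf lab σ → S′ ⊆ classOf (lab′ σ) (not σ) →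
    Round (∣ S ∣) (∣ classOf lab σ ∣) (∣ classOf lab (not σ) ∣) (changes S (init S′))
          (∣ S′ ∣) (∣ classOf (lab′ σ) (not σ) ∣) (∣ classOf (lab′ σ) (not (not σ)) ∣)
  round-switch σ S⊆ S′⊆ = switch
    (ℕ.≤-trans (ℕ.+-monoʳ-≤ ∣ S ∣ (∣p∣≤1+∣init∣ S′))
      (ℕ.≤-trans (ℕ.≤-reflexive (ℕ.+-suc ∣ S ∣ _))
        (s≤s (disjoint⇒∣p∣+∣q∣≤changes S (init S′) old∉S′))))
    (∣classOf-∷ʳ∣ lab (not σ))
    (trans (cong (λ b → ∣ classOf (lab′ σ) b ∣) (not-involutive σ)) (∣classOf-∷ʳ-not∣ lab σ))
    where
    old∉S′ : ∀ {i} → i ∈ S → i ∉ init S′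
    old∉S′ {i} i∈S i∈S′ = not-¬ (∈classOf⁻ lab σ (S⊆ i∈S)) (begin
      lookup lab i                ≡⟨ lookup-∷ʳ-inject₁ lab (not σ) i ⟨
      lookup (lab′ σ) (inject₁ i) ≡⟨ ∈classOf⁻ (lab′ σ) (not σ) (S′⊆ (∈init⇒inject₁∈ S′ i∈S′)) ⟩
      not σ                       ∎)
      where open ≡-Reasoning

  ⊆classOf⇒Round : ∀ σ σ′ → S ⊆ classOf lab σ → S′ ⊆ classOf (lab′ σ) σ′ →
    Round (∣ S ∣) (∣ classOf lab σ ∣) (∣ classOf lab (not σ) ∣) (changes S (init S′))
          (∣ S′ ∣) (∣ classOf (lab′ σ) σ′ ∣) (∣ classOf (lab′ σ) (not σ′) ∣)
  ⊆classOf⇒Round false false = round-stay false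
  ⊆classOf⇒Round true  true  = round-stay true
  ⊆classOf⇒Round false true  = round-switch false
  ⊆classOf⇒Round true  false = round-switch true

-- The adversary

module Adversary (A : OnlineAlg) where

  record Position (n : ℕ) : Set where
    constructor position
    field
      graph  : Arrivals n
      labels : Vec Bool n
      side   : Bool

  open Position public

  -- side is the label of the vertices holding the algorithm's set; the new vertex gets the other label
  -- and is adjacent to exactly the vertices labelled side.
  play : ∀ n → Position n
  play zero    = position [] [] false
  play (suc n) = position graph′ labels′ (nextSide (A (suc n) graph′) labels′ (side (play n)))
    where
    graph′ : Arrivals (suc n)
    graph′ = graph (play n) ▷ classOf (labels (play n)) (side (play n))
    labels′ : Vec Bool (suc n)
    labels′ = labels (play n) ∷ʳ not (side (play n))

  chosen : ∀ n → Subset n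
  chosen n = A n (graph (play n))

  play-completeBipartite : ∀ n → CompleteBipartite (graph (play n)) (labels (play n))
  play-completeBipartite zero    ()
  play-completeBipartite (suc n) =
    ▷classOf-completeBipartite (graph (play n)) (labels (play n)) (play-completeBipartite n) (side (play n))

  play-classOf-independent : ∀ n b → Independent (graph (play n)) (classOf (labels (play n)) b)
  play-classOf-independent n = classOf-independent (graph (play n)) (labels (play n)) (play-completeBipartite n)

  chosen⊆side : Valid A → ∀ n → chosen n ⊆ classOf (labels (play n)) (side (play n))
  chosen⊆side valid zero    {()}
  chosen⊆side valid (suc n) = monochromatic⇒⊆classOf-nextSide (chosen (suc n)) _ (side (play n))
    (independent⇒monochromatic (graph (play (suc n))) (labels (play (suc n))) (play-completeBipartite (suc n))
      (valid (suc n) _))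

ℚ-ring : ACR.AlmostCommutativeRing _ _
ℚ-ring = ACR.fromCommutativeRing ℚ.+-*-commutativeRing (λ x → dec⇒maybe (0ℚ ℚ.≟ x))

ι : ℕ → ℚ
ι n = + n / 1

private
  ι≡mkℚ : ∀ n → ι n ≡ mkℚ (+ n) 0 (Coprime.sym (1-coprimeTo n))
  ι≡mkℚ n = ℚ.normalize-coprime (Coprime.sym (1-coprimeTo n))

  toℚᵘ-ι : ∀ n → toℚᵘ (ι n) ℚᵘ.≃ ℚᵘ.mkℚᵘ (+ n) 0
  toℚᵘ-ι n = ℚ.toℚᵘ-fromℚᵘ (ℚᵘ.mkℚᵘ (+ n) 0)

ι-+ : ∀ m n → ι (m ℕ.+ n) ≡ ι m + ι n
ι-+ m n = ℚ.toℚᵘ-injective (begin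
  toℚᵘ (ι (m ℕ.+ n))                    ≈⟨ toℚᵘ-ι (m ℕ.+ n) ⟩
  ℚᵘ.mkℚᵘ (+ (m ℕ.+ n)) 0               ≈⟨ ℚᵘ.*≡* (cong (ℤ._* + 1) +[m+n]≡m*1+n*1) ⟩
  ℚᵘ.mkℚᵘ (+ m) 0 ℚᵘ.+ ℚᵘ.mkℚᵘ (+ n) 0  ≈⟨ ℚᵘ.+-cong (toℚᵘ-ι m) (toℚᵘ-ι n) ⟨
  toℚᵘ (ι m) ℚᵘ.+ toℚᵘ (ι n)            ≈⟨ ℚ.toℚᵘ-homo-+ (ι m) (ι n) ⟨
  toℚᵘ (ι m + ι n)                      ∎)
  where
  open ℚᵘ.≃-Reasoning
  +[m+n]≡m*1+n*1 : + (m ℕ.+ n) ≡ + m ℤ.* + 1 ℤ.+ + n ℤ.* + 1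
  +[m+n]≡m*1+n*1 = trans (ℤ.pos-+ m n) (sym (cong₂ ℤ._+_ (ℤ.*-identityʳ (+ m)) (ℤ.*-identityʳ (+ n))))

ι-suc : ∀ n → ι (suc n) ≡ 1ℚ + ι n
ι-suc n = ι-+ 1 n

ι-mono-≤ : ∀ {m n} → m ℕ.≤ n → ι m ≤ ι n
ι-mono-≤ {m} {n} m≤n rewrite ι≡mkℚ m | ι≡mkℚ n =
  *≤* (subst₂ ℤ._≤_ (sym (ℤ.*-identityʳ (+ m))) (sym (ℤ.*-identityʳ (+ n))) (ℤ.+≤+ m≤n))

ι-mono-≤-+ : ∀ {m} n l → m ℕ.≤ n ℕ.+ l → ι m ≤ ι n + ι l
ι-mono-≤-+ n l m≤n+l = subst (_ ≤_) (ι-+ n l) (ι-mono-≤ m≤n+l)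

0≤ι : ∀ n → 0ℚ ≤ ι n
0≤ι n = ι-mono-≤ {0} {n} z≤n

ι-suc-positive : ∀ n → Positive (ι (suc n))
ι-suc-positive n rewrite ι≡mkℚ (suc n) = _

/-suc*ι-suc : ∀ m n → (+ m / suc n) * ι (suc n) ≡ ι m
/-suc*ι-suc m n = ℚ.toℚᵘ-injective (begin
  toℚᵘ ((+ m / suc n) * ι (suc n))          ≈⟨ ℚ.toℚᵘ-homo-* (+ m / suc n) (ι (suc n)) ⟩
  toℚᵘ (+ m / suc n) ℚᵘ.* toℚᵘ (ι (suc n))  ≈⟨ ℚᵘ.*-cong (ℚ.toℚᵘ-fromℚᵘ (ℚᵘ.mkℚᵘ (+ m) n)) (toℚᵘ-ι (suc n)) ⟩
  ℚᵘ.mkℚᵘ (+ m) n ℚᵘ.* ℚᵘ.mkℚᵘ (+ suc n) 0  ≈⟨ ℚᵘ.*≡* m*[1+n]≡m*[1+n*1] ⟩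
  ℚᵘ.mkℚᵘ (+ m) 0                           ≈⟨ toℚᵘ-ι m ⟨
  toℚᵘ (ι m)                                ∎)
  where
  open ℚᵘ.≃-Reasoning
  m*[1+n]≡m*[1+n*1] : + m ℤ.* + suc n ℤ.* + 1 ≡ + m ℤ.* + suc (n ℕ.* 1)
  m*[1+n]≡m*[1+n*1] = trans (ℤ.*-identityʳ _) (cong (λ k → + m ℤ.* + suc k) (sym (ℕ.*-identityʳ n)))

p*ι[1+n]≤ι[m]⇒p≤m/[1+n] : ∀ p m n → p * ι (suc n) ≤ ι m → p ≤ + m / suc n
p*ι[1+n]≤ι[m]⇒p≤m/[1+n] p m n h =
  ℚ.*-cancelʳ-≤-pos (ι (suc n)) {{ι-suc-positive n}} (ℚ.≤-trans h (ℚ.≤-reflexive (sym (/-suc*ι-suc m n))))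

archimedean : ∀ p → ∃ λ K → p ≤ ι K
archimedean p@(mkℚ n d-1 _) = ℤ.∣ n ∣ , subst (p ≤_) (sym (ι≡mkℚ ℤ.∣ n ∣)) (*≤* (n≤∣n∣*d n))
  where
  n≤∣n∣*d : ∀ n → n ℤ.* + 1 ℤ.≤ + ℤ.∣ n ∣ ℤ.* + suc d-1
  n≤∣n∣*d (+ m)      =
    subst₂ ℤ._≤_ (ℤ.pos-* m 1) (ℤ.pos-* m (suc d-1)) (ℤ.+≤+ (ℕ.*-monoʳ-≤ m (s≤s z≤n)))
  n≤∣n∣*d ℤ.-[1+ m ] = ℤ.-≤+

archimedean-* : ∀ p q .{{_ : Positive q}} → ∃ λ K → p ≤ q * ι K
archimedean-* p q = K , (begin
  p              ≡⟨ q*[p*1/q]≡p ⟨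
  q * (p * 1/ q) ≤⟨ ℚ.*-monoˡ-≤-nonNeg q {{ℚ.pos⇒nonNeg q}} (proj₂ (archimedean (p * 1/ q))) ⟩
  q * ι K        ∎)
  where
  open ℚ.≤-Reasoning
  instance
    q≢0 : ℚ.NonZero q
    q≢0 = ℚ.pos⇒nonZero q
  K : ℕ
  K = proj₁ (archimedean (p * 1/ q))
  q*[p*1/q]≡p : q * (p * 1/ q) ≡ p
  q*[p*1/q]≡p = trans (ℚ.*-comm q _)
    (trans (ℚ.*-assoc p (1/ q) q) (trans (cong (p *_) (ℚ.*-inverseˡ q)) (ℚ.*-identityʳ p)))

0≤q-p⇒p≤q : ∀ {p q} → 0ℚ ≤ q - p → p ≤ q
0≤q-p⇒p≤q {p} {q} 0≤q-p = subst₂ _≤_ (ℚ.+-identityˡ p) (q-p+p≡q p q) (ℚ.+-monoˡ-≤ p 0≤q-p)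
  where
  q-p+p≡q : ∀ p q → q - p + p ≡ q
  q-p+p≡q = solve-∀ ℚ-ring

p≤q⇒0≤q-p : ∀ {p q} → p ≤ q → 0ℚ ≤ q - p
p≤q⇒0≤q-p {p} {q} p≤q = subst (_≤ q - p) (ℚ.+-inverseʳ p) (ℚ.+-monoˡ-≤ (- p) p≤q)

0≤p*q : ∀ {p q} → 0ℚ ≤ p → 0ℚ ≤ q → 0ℚ ≤ p * q
0≤p*q {p} 0≤p 0≤q = subst (_≤ p * _) (ℚ.*-zeroʳ p) (ℚ.*-monoˡ-≤-nonNeg p {{ℚ.nonNegative 0≤p}} 0≤q)

0≤p+q : ∀ {p q} → 0ℚ ≤ p → 0ℚ ≤ q → 0ℚ ≤ p + q
0≤p+q = ℚ.+-mono-≤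

p≤p+q : ∀ {p q} → 0ℚ ≤ q → p ≤ p + q
p≤p+q {p} 0≤q = subst (_≤ p + _) (ℚ.+-identityʳ p) (ℚ.+-monoʳ-≤ p 0≤q)

+-cancelʳ-≤ : ∀ {p q} r → p + r ≤ q + r → p ≤ q
+-cancelʳ-≤ {p} {q} r p+r≤q+r = subst₂ _≤_ (p+r-r≡p p r) (p+r-r≡p q r) (ℚ.+-monoˡ-≤ (- r) p+r≤q+r)
  where
  p+r-r≡p : ∀ p r → p + r - r ≡ p
  p+r-r≡p = solve-∀ ℚ-ring

drift-bound : ∀ (f : ℕ → ℚ) a K → (∀ k → f k ≤ f (suc k) + a) → (∀ k → K ℕ.≤ k → f k ≤ f (suc k)) →
  ∀ j → f 0 ≤ f (K ℕ.+ j) + a * ι K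
drift-bound f a K drop mono j = ℚ.≤-trans (until K) (ℚ.+-monoˡ-≤ (a * ι K) (after j))
  where
  open ℚ.≤-Reasoning
  until : ∀ k → f 0 ≤ f k + a * ι k
  until zero    = ℚ.≤-reflexive (sym (trans (cong (λ x → f 0 + x) (ℚ.*-zeroʳ a)) (ℚ.+-identityʳ (f 0))))
  until (suc k) = begin
    f 0                         ≤⟨ until k ⟩
    f k + a * ι k               ≤⟨ ℚ.+-monoˡ-≤ (a * ι k) (drop k) ⟩
    f (suc k) + a + a * ι k     ≡⟨ regroup (f (suc k)) a (ι k) ⟩
    f (suc k) + a * (1ℚ + ι k)  ≡⟨ cong (λ x → f (suc k) + a * x) (ι-suc k) ⟨
    f (suc k) + a * ι (suc k)   ∎
    where
    regroup : ∀ x a n → x + a + a * n ≡ x + a * (1ℚ + n)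
    regroup = solve-∀ ℚ-ring
  after : ∀ j → f K ≤ f (K ℕ.+ j)
  after zero    = ℚ.≤-reflexive (cong f (sym (ℕ.+-identityʳ K)))
  after (suc j) = begin
    f K               ≤⟨ after j ⟩
    f (K ℕ.+ j)       ≤⟨ mono (K ℕ.+ j) (ℕ.m≤m+n K j) ⟩
    f (suc (K ℕ.+ j)) ≡⟨ cong f (ℕ.+-suc K j) ⟨
    f (K ℕ.+ suc j)   ∎

-- The potential argument

record Game (t : ℚ) : Set where
  field
    s p q c R : ℕ → ℕ
    p-zero : p 0 ≡ 0
    q-zero : q 0 ≡ 0
    R-zero : R 0 ≡ 0
    R-suc  : ∀ k → R (suc k) ≡ R k ℕ.+ c k
    s≤p    : ∀ k → s k ℕ.≤ p k
    p≤t*s  : ∀ k → ι (p k) ≤ t * ι (s k)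
    q≤t*s  : ∀ k → ι (q k) ≤ t * ι (s k)
    round  : ∀ k → Round (s k) (p k) (q k) (c k) (s (suc k)) (p (suc k)) (q (suc k))

module Accounting {t} (game : Game t) (1<t : 1ℚ < t) {ε} (0<ε : 0ℚ < ε) where
  open Game game

  u : ℚ
  u = t - 1ℚ

  -- chosen so that (1/u − ε)(u + δ) = 1 − εδ
  δ : ℚ
  δ = ε * u * u

  loss : ℚ
  loss = u + 1ℚ + 1ℚ

  instance
    u-positive : Positive u
    u-positive = 1<⇒pos t 1<t

    δ-positive : Positive δ
    δ-positive = ℚ.pos*pos⇒pos (ε * u) {{ℚ.pos*pos⇒pos ε {{ℚ.positive 0<ε}} u}} u

  0≤u : 0ℚ ≤ u
  0≤u = ℚ.nonNegative⁻¹ u {{ℚ.pos⇒nonNeg u}}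

  0≤δ : 0ℚ ≤ δ
  0≤δ = ℚ.nonNegative⁻¹ δ {{ℚ.pos⇒nonNeg δ}}

  0≤loss : 0ℚ ≤ loss
  0≤loss = 0≤p+q (0≤p+q 0≤u (ℚ.nonNegative⁻¹ 1ℚ)) (ℚ.nonNegative⁻¹ 1ℚ)

  excess : (s p q : ℚ) → ℚ
  excess s p q = u * s + p - q

  potential : (R n s p q : ℚ) → ℚ
  potential R n s p q = (u + δ) * R - n - excess s p q

  excess-nonneg : ∀ {s p q} → s ≤ p → q ≤ t * s → 0ℚ ≤ excess s p q
  excess-nonneg {s} {p} {q} s≤p q≤ts =
    subst (0ℚ ≤_) (regroup t s p q) (0≤p+q (p≤q⇒0≤q-p q≤ts) (p≤q⇒0≤q-p s≤p))
    where
    regroup : ∀ t s p q → (t * s - q) + (p - s) ≡ (t - 1ℚ) * s + p - q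
    regroup = solve-∀ ℚ-ring

  potential-stay : ∀ {R c n s s′ p q} → 0ℚ ≤ c → s′ ≤ s + c →
    potential R n s p q ≤ potential (R + c) (1ℚ + n) s′ p (1ℚ + q)
  potential-stay {R} {c} {n} {s} {s′} {p} {q} 0≤c s′≤s+c =
    0≤q-p⇒p≤q (subst (0ℚ ≤_) (sym (gain u δ R c n s s′ p q))
      (0≤p+q (0≤p*q 0≤u (p≤q⇒0≤q-p s′≤s+c)) (0≤p*q 0≤δ 0≤c)))
    where
    gain : ∀ u δ R c n s s′ p q →
      ((u + δ) * (R + c) - (1ℚ + n) - (u * s′ + p - (1ℚ + q))) - ((u + δ) * R - n - (u * s + p - q))
      ≡ u * (s + c - s′) + δ * c
    gain = solve-∀ ℚ-ring

  potential-switch : ∀ {R c n s s′ p q} → 0ℚ ≤ excess s p q → s + s′ ≤ 1ℚ + c →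
    potential R n s p q + δ * c ≤ potential (R + c) (1ℚ + n) s′ (1ℚ + q) p + loss
  potential-switch {R} {c} {n} {s} {s′} {p} {q} 0≤e s+s′≤1+c =
    0≤q-p⇒p≤q (subst (0ℚ ≤_) (sym (gain u δ R c n s s′ p q))
      (0≤p+q (0≤p*q 0≤u (p≤q⇒0≤q-p s+s′≤1+c)) (0≤p+q 0≤e 0≤e)))
    where
    gain : ∀ u δ R c n s s′ p q →
      ((u + δ) * (R + c) - (1ℚ + n) - (u * s′ + (1ℚ + q) - p) + (u + 1ℚ + 1ℚ))
        - ((u + δ) * R - n - (u * s + p - q) + δ * c)
      ≡ u * (1ℚ + c - (s + s′)) + ((u * s + p - q) + (u * s + p - q))
    gain = solve-∀ ℚ-ring

  loss≤δ*c : ∀ {N s′ c} → N ≤ (t + t) * s′ → s′ ≤ 1ℚ + c → (t + t) * (loss + δ) ≤ δ * N → loss ≤ δ * c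
  loss≤δ*c {N} {s′} {c} N≤[t+t]s′ s′≤1+c [t+t][loss+δ]≤δN = +-cancelʳ-≤ δ (begin
    loss + δ      ≤⟨ ℚ.*-cancelˡ-≤-pos (t + t) {{t+t-positive}} (ℚ.≤-trans [t+t][loss+δ]≤δN δN≤) ⟩
    δ * s′        ≤⟨ ℚ.*-monoˡ-≤-nonNeg δ {{ℚ.pos⇒nonNeg δ}} s′≤1+c ⟩
    δ * (1ℚ + c)  ≡⟨ regroup δ c ⟩
    δ * c + δ     ∎)
    where
    open ℚ.≤-Reasoning
    t+t-positive : Positive (t + t)
    t+t-positive = ℚ.pos+pos⇒pos t t
      where instance _ = ℚ.positive (ℚ.<-trans (ℚ.positive⁻¹ 1ℚ) 1<t)
    regroup : ∀ δ c → δ * (1ℚ + c) ≡ δ * c + δ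
    regroup = solve-∀ ℚ-ring
    swap : ∀ x y z → x * (y * z) ≡ y * (x * z)
    swap = solve-∀ ℚ-ring
    δN≤ : δ * N ≤ (t + t) * (δ * s′)
    δN≤ = ℚ.≤-trans (ℚ.*-monoˡ-≤-nonNeg δ {{ℚ.pos⇒nonNeg δ}} N≤[t+t]s′)
      (ℚ.≤-reflexive (swap δ (t + t) s′))

  Ψ : ℕ → ℚ
  Ψ k = potential (ι (R k)) (ι k) (ι (s k)) (ι (p k)) (ι (q k))

  p+q≡k : ∀ k → p k ℕ.+ q k ≡ k
  p+q≡k zero = cong₂ ℕ._+_ p-zero q-zero
  p+q≡k (suc k) with round k
  ... | stay _ p′≡p q′≡1+q =
    trans (cong₂ ℕ._+_ p′≡p q′≡1+q) (trans (ℕ.+-suc (p k) (q k)) (cong suc (p+q≡k k)))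
  ... | switch _ p′≡1+q q′≡p =
    trans (cong₂ ℕ._+_ p′≡1+q q′≡p) (cong suc (trans (ℕ.+-comm (q k) (p k)) (p+q≡k k)))

  excess-nonneg-at : ∀ k → 0ℚ ≤ excess (ι (s k)) (ι (p k)) (ι (q k))
  excess-nonneg-at k = excess-nonneg (ι-mono-≤ (s≤p k)) (q≤t*s k)

  Ψ-zero : Ψ 0 ≡ 0ℚ
  Ψ-zero rewrite R-zero | p-zero | q-zero | ℕ.n≤0⇒n≡0 (subst (s 0 ℕ.≤_) p-zero (s≤p 0)) = vanish u δ
    where
    vanish : ∀ u δ → (u + δ) * 0ℚ - 0ℚ - (u * 0ℚ + 0ℚ - 0ℚ) ≡ 0ℚ
    vanish = solve-∀ ℚ-ring

  Ψ-suc : ∀ k {p′ q′} → ι (p (suc k)) ≡ p′ → ι (q (suc k)) ≡ q′ →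
    Ψ (suc k) ≡ potential (ι (R k) + ι (c k)) (1ℚ + ι k) (ι (s (suc k))) p′ q′
  Ψ-suc k refl refl = cong₂ (λ R n → potential R n (ι (s (suc k))) (ι (p (suc k))) (ι (q (suc k))))
    (trans (cong ι (R-suc k)) (ι-+ (R k) (c k))) (ι-suc k)

  Ψ-stay : ∀ k → s (suc k) ℕ.≤ s k ℕ.+ c k → p (suc k) ≡ p k → q (suc k) ≡ suc (q k) → Ψ k ≤ Ψ (suc k)
  Ψ-stay k s′≤s+c p′≡p q′≡1+q = begin
    Ψ k        ≤⟨ potential-stay (0≤ι (c k)) (ι-mono-≤-+ (s k) (c k) s′≤s+c) ⟩
    _          ≡⟨ Ψ-suc k (cong ι p′≡p) (trans (cong ι q′≡1+q) (ι-suc (q k))) ⟨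
    Ψ (suc k)  ∎
    where open ℚ.≤-Reasoning

  Ψ-switch : ∀ k → s k ℕ.+ s (suc k) ℕ.≤ suc (c k) → p (suc k) ≡ suc (q k) → q (suc k) ≡ p k →
    Ψ k + δ * ι (c k) ≤ Ψ (suc k) + loss
  Ψ-switch k s+s′≤1+c p′≡1+q q′≡p = begin
    Ψ k + δ * ι (c k)  ≤⟨ potential-switch (excess-nonneg-at k) s+s′≤1+c′ ⟩
    _                  ≡⟨ cong (_+ loss) (Ψ-suc k (trans (cong ι p′≡1+q) (ι-suc (q k))) (cong ι q′≡p)) ⟨
    Ψ (suc k) + loss   ∎
    where
    open ℚ.≤-Reasoning
    s+s′≤1+c′ : ι (s k) + ι (s (suc k)) ≤ 1ℚ + ι (c k)
    s+s′≤1+c′ = subst₂ _≤_ (ι-+ (s k) (s (suc k))) (ι-suc (c k)) (ι-mono-≤ s+s′≤1+c)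

  Θ : ℚ
  Θ = (t + t) * (loss + δ)

  -- a switching round after k arrivals costs at least |S′| − 1 ≥ (k + 1)/(2t) − 1
  late-switch-loss≤δ*c : ∀ k → s k ℕ.+ s (suc k) ℕ.≤ suc (c k) → Θ ≤ δ * ι (suc k) → loss ≤ δ * ι (c k)
  late-switch-loss≤δ*c k s+s′≤1+c = loss≤δ*c 1+k≤[t+t]s′ s′≤1+c
    where
    open ℚ.≤-Reasoning
    1+k≤[t+t]s′ : ι (suc k) ≤ (t + t) * ι (s (suc k))
    1+k≤[t+t]s′ = begin
      ι (suc k)                              ≡⟨ cong ι (p+q≡k (suc k)) ⟨
      ι (p (suc k) ℕ.+ q (suc k))            ≡⟨ ι-+ (p (suc k)) (q (suc k)) ⟩
      ι (p (suc k)) + ι (q (suc k))          ≤⟨ ℚ.+-mono-≤ (p≤t*s (suc k)) (q≤t*s (suc k)) ⟩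
      t * ι (s (suc k)) + t * ι (s (suc k))  ≡⟨ ℚ.*-distribʳ-+ (ι (s (suc k))) t t ⟨
      (t + t) * ι (s (suc k))                ∎
    s′≤1+c : ι (s (suc k)) ≤ 1ℚ + ι (c k)
    s′≤1+c = subst (ι (s (suc k)) ≤_) (ι-suc (c k))
      (ι-mono-≤ (ℕ.≤-trans (ℕ.m≤n+m (s (suc k)) (s k)) s+s′≤1+c))

  Ψ-drop : ∀ k → Ψ k ≤ Ψ (suc k) + loss
  Ψ-drop k with round k
  ... | stay s′≤s+c p′≡p q′≡1+q = ℚ.≤-trans (Ψ-stay k s′≤s+c p′≡p q′≡1+q) (p≤p+q 0≤loss)
  ... | switch s+s′≤1+c p′≡1+q q′≡p =
    ℚ.≤-trans (p≤p+q (0≤p*q 0≤δ (0≤ι (c k)))) (Ψ-switch k s+s′≤1+c p′≡1+q q′≡p)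

  Ψ-mono-late : ∀ k → Θ ≤ δ * ι (suc k) → Ψ k ≤ Ψ (suc k)
  Ψ-mono-late k Θ≤δ[1+k] with round k
  ... | stay s′≤s+c p′≡p q′≡1+q = Ψ-stay k s′≤s+c p′≡p q′≡1+q
  ... | switch s+s′≤1+c p′≡1+q q′≡p = +-cancelʳ-≤ loss (begin
    Ψ k + loss         ≤⟨ ℚ.+-monoʳ-≤ (Ψ k) (late-switch-loss≤δ*c k s+s′≤1+c Θ≤δ[1+k]) ⟩
    Ψ k + δ * ι (c k)  ≤⟨ Ψ-switch k s+s′≤1+c p′≡1+q q′≡p ⟩
    Ψ (suc k) + loss   ∎)
    where open ℚ.≤-Reasoning

  inv : ℚ
  inv = inv[t-1] t 1<t

  [u+δ]*[inv-ε]*N≡N-εδN : ∀ N → (u + δ) * ((inv - ε) * N) ≡ N - ε * δ * N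
  [u+δ]*[inv-ε]*N≡N-εδN N = begin
    (u + δ) * ((inv - ε) * N)
      ≡⟨ expand u ε inv N ⟩
    u * inv * N + ε * u * (u * inv) * N - ε * u * N - ε * δ * N
      ≡⟨ cong (λ x → x * N + ε * u * x * N - ε * u * N - ε * δ * N) u*inv≡1 ⟩
    1ℚ * N + ε * u * 1ℚ * N - ε * u * N - ε * δ * N
      ≡⟨ collapse ε u δ N ⟩
    N - ε * δ * N
      ∎
    where
    open ≡-Reasoning
    u*inv≡1 : u * inv ≡ 1ℚ
    u*inv≡1 = ℚ.*-inverseʳ u {{ℚ.pos⇒nonZero u}}
    expand : ∀ u ε i N →
      (u + ε * u * u) * ((i - ε) * N) ≡ u * i * N + ε * u * (u * i) * N - ε * u * N - ε * (ε * u * u) * N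
    expand = solve-∀ ℚ-ring
    collapse : ∀ ε u δ N → 1ℚ * N + ε * u * 1ℚ * N - ε * u * N - ε * δ * N ≡ N - ε * δ * N
    collapse = solve-∀ ℚ-ring

  recourse-bound : ∀ {R N s p q L} → 0ℚ ≤ potential R N s p q + L → 0ℚ ≤ excess s p q → L ≤ ε * δ * N →
    (inv - ε) * N ≤ R
  recourse-bound {R} {N} {s} {p} {q} {L} 0≤Ψ+L 0≤e L≤εδN = ℚ.*-cancelˡ-≤-pos (u + δ) {{ℚ.pos+pos⇒pos u δ}}
    (0≤q-p⇒p≤q (subst (0ℚ ≤_) difference (0≤p+q (0≤p+q 0≤Ψ+L 0≤e) (p≤q⇒0≤q-p L≤εδN))))
    where
    split : ∀ u δ R N s p q L x →
      ((u + δ) * R - N - (u * s + p - q) + L) + (u * s + p - q) + (x - L) ≡ (u + δ) * R - (N - x)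
    split = solve-∀ ℚ-ring
    difference : potential R N s p q + L + excess s p q + (ε * δ * N - L) ≡ (u + δ) * R - (u + δ) * ((inv - ε) * N)
    difference = trans (split u δ R N s p q L (ε * δ * N))
      (cong (λ x → (u + δ) * R - x) (sym ([u+δ]*[inv-ε]*N≡N-εδN N)))

  K₀ : ℕ
  K₀ = proj₁ (archimedean-* Θ δ)

  L : ℚ
  L = loss * ι K₀

  K₁ : ℕ
  K₁ = proj₁ (archimedean-* L (ε * δ) {{ℚ.pos*pos⇒pos ε {{ℚ.positive 0<ε}} δ}})

  n : ℕ
  n = K₀ ℕ.+ K₁

  Ψ-bounded : 0ℚ ≤ Ψ (suc n) + L
  Ψ-bounded = subst₂ _≤_ Ψ-zero (cong (λ k → Ψ k + L) (ℕ.+-suc K₀ K₁))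
    (drift-bound Ψ loss K₀ Ψ-drop late (suc K₁))
    where
    late : ∀ k → K₀ ℕ.≤ k → Ψ k ≤ Ψ (suc k)
    late k K₀≤k = Ψ-mono-late k (ℚ.≤-trans (proj₂ (archimedean-* Θ δ))
      (ℚ.*-monoˡ-≤-nonNeg δ {{ℚ.pos⇒nonNeg δ}} (ι-mono-≤ (ℕ.m≤n⇒m≤1+n K₀≤k))))

  L≤εδ[1+n] : L ≤ ε * δ * ι (suc n)
  L≤εδ[1+n] = ℚ.≤-trans (proj₂ (archimedean-* L (ε * δ) {{ℚ.pos*pos⇒pos ε {{ℚ.positive 0<ε}} δ}}))
    (ℚ.*-monoˡ-≤-nonNeg (ε * δ) {{ℚ.nonNegative (0≤p*q (ℚ.<⇒≤ 0<ε) 0≤δ)}}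
      (ι-mono-≤ (ℕ.m≤n⇒m≤1+n (ℕ.m≤n+m K₁ K₀))))

  recourse-lower-bound : ∃ λ n → inv - ε ≤ + R (suc n) / suc n
  recourse-lower-bound = n , p*ι[1+n]≤ι[m]⇒p≤m/[1+n] (inv - ε) (R (suc n)) n
    (recourse-bound Ψ-bounded (excess-nonneg-at (suc n)) L≤εδ[1+n])

adversary-game : ∀ {t} (A : OnlineAlg) → Valid A → Competitive t A → Game t
adversary-game A valid competitive = record
  { s      = λ k → ∣ chosen k ∣
  ; p      = λ k → ∣ classOf (labels (play k)) (side (play k)) ∣
  ; q      = λ k → ∣ classOf (labels (play k)) (not (side (play k))) ∣
  ; c      = λ k → changes (chosen k) (init (chosen (suc k)))
  ; R      = λ k → recourse A (graph (play k))
  ; p-zero = refl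
  ; q-zero = refl
  ; R-zero = refl
  ; R-suc  = λ _ → refl
  ; s≤p    = λ k → p⊆q⇒∣p∣≤∣q∣ (chosen⊆side valid k)
  ; p≤t*s  = λ k → competitive k _ _ (play-classOf-independent k _)
  ; q≤t*s  = λ k → competitive k _ _ (play-classOf-independent k _)
  ; round  = λ k → ⊆classOf⇒Round (labels (play k)) (chosen k) (chosen (suc k)) _ _
                     (chosen⊆side valid k) (chosen⊆side valid (suc k))
  }
  where open Adversary A

mainTheorem6 : (t : ℚ) (1<t : 1ℚ < t) → t ≤ (+ 2) / 1 → (ε : ℚ) → 0ℚ < ε →
    (A : OnlineAlg) → Valid A → Competitive t A →
    Σ ℕ (λ n → Σ (Arrivals (suc n)) (λ G →
    inv[t-1] t 1<t - ε ≤ amortizedRecourse A G))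
mainTheorem6 t 1<t _ ε 0<ε A valid competitive =
  let n , bound = Accounting.recourse-lower-bound (adversary-game A valid competitive) 1<t 0<ε
  in n , Adversary.graph (Adversary.play A (suc n)) , bound
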